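{- Let $H$ be a finite abelian group of order $n$ and let $G=\langle H,g\rangle$ be the generalized dihedral group associated with $H$, i.e. $g\notin H$, $g^2=e$ and $h^g=h^{ -1}$ for all $h\in H$. Let $A=H\setminus\{e\}$ and let $D\subset H$ be a difference set in $H$, i.e. $(\underline{D}\cdot\underline{D^{ -1}})\circ\underline{A}=\lambda\underline{A}$ for some positive integer $\lambda$. Let $\mathcal S$ be the partition of $G$ into the four classes $\{e\}$, $A$, $X=Dg$, $Y=(H\setminus D)g$. Then the $\mathbb Z$-module $\mathcal A(D,H)=\mathrm{Span}_{\mathbb Z}\{\underline Z: Z\in\mathcal S\}$ is an S-ring over $G$.
   Context: For a subset $Z$ of a group, $\underline Z$ denotes the sum of its elements in the integral group ring and $Z^{ -1}=\{z^{ -1}:z\in Z\}$. The operation $\circ$ is componentwise (Hadamard) multiplication in $\mathbb Z H$: $(\sum a_h h)\circ(\sum b_h h)=\sum a_hb_h h$. An S-ring over a finite group $G$ with identity $e$ is a subring of $\mathbb ZG$ of the form $\mathrm{Span}_{\mathbb Z}\{\underline Z:Z\in\mathcal S\}$ where $\mathcal S$ is a partition of $G$ with $\{e\}\in\mathcal S$ and $Z^{ -1}\in\mathcal S$ for all $Z\in\mathcal S$. -}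

module Defs where

open import Data.Nat using (ℕ; zero; suc)
open import Data.Fin using (Fin; zero; suc)
open import Data.Fin.Properties using (_≟_)
open import Data.Bool using (Bool; true; false; not; _xor_; _∧_; if_then_else_)
open import Data.Bool.Properties using () renaming (_≟_ to _B≟_)
open import Data.Integer using (ℤ; 0ℤ; 1ℤ; _+_; _*_; -_)
open import Data.Product using (Σ; _×_; _,_; ∃)
open import Data.List using (List; length; lookup; _∷_; [])
open import Relation.Nullary using (does)
open import Relation.Binary.PropositionalEquality using (_≡_)

record FinAbGroup (n : ℕ) : Set where
  field
    _·_     : Fin n → Fin n → Fin n
    e       : Fin n
    inv     : Fin n → Fin n
    assoc   : ∀ x y z → (x · y) · z ≡ x · (y · z)
    identityˡ : ∀ x → e · x ≡ x
    identityʳ : ∀ x → x · e ≡ x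
    inverseˡ : ∀ x → inv x · x ≡ e
    inverseʳ : ∀ x → x · inv x ≡ e
    comm    : ∀ x y → x · y ≡ y · x

sumFin : (m : ℕ) → (Fin m → ℤ) → ℤ
sumFin zero    f = 0ℤ
sumFin (suc m) f = f zero + sumFin m (λ i → f (suc i))

ind : {A : Set} → (A → Bool) → A → ℤ
ind Z x = if Z x then 1ℤ else 0ℤ

module Dihedral {n : ℕ} (H : FinAbGroup n) where
  open FinAbGroup H

  ZH : Set
  ZH = Fin n → ℤ

  sumH : (Fin n → ℤ) → ℤ
  sumH = sumFin n

  mulZH : ZH → ZH → ZH
  mulZH a b x = sumH (λ y → a y * b (inv y · x))

  _∘H_ : ZH → ZH → ZH
  (a ∘H b) x = a x * b x

  invSetH : (Fin n → Bool) → Fin n → Bool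
  invSetH Z x = Z (inv x)

  Aset : Fin n → Bool
  Aset x = not (does (x ≟ e))

  IsDifferenceSet : (Fin n → Bool) → ℤ → Set
  IsDifferenceSet D λ' =
    ∀ x → (mulZH (ind D) (ind (invSetH D)) ∘H ind Aset) x ≡ λ' * ind Aset x

  -- Generalized dihedral group G = ⟨H, g⟩ = H ⋊ C₂ ;
  -- (h , false) stands for h, (h , true) stands for h g.
  -- g ∉ H, g² = e, g⁻¹ h g = h⁻¹.

  G : Set
  G = Fin n × Bool

  eG : G
  eG = (e , false)

  gG : G
  gG = (e , true)

  -- (h g^a)(k g^b) = h k^{(-1)^a} g^{a+b}
  _·G_ : G → G → G
  (h , a) ·G (k , b) = (h · (if a then inv k else k)) , (a xor b)

  invG : G → G
  invG (h , false) = (inv h , false)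
  invG (h , true)  = (h , true)

  ZG : Set
  ZG = G → ℤ

  sumG : (G → ℤ) → ℤ
  sumG f = sumH (λ h → f (h , false)) + sumH (λ h → f (h , true))

  _+G_ : ZG → ZG → ZG
  (a +G b) x = a x + b x

  negG : ZG → ZG
  negG a x = - a x

  zeroG : ZG
  zeroG x = 0ℤ

  _≟G_ : G → G → Bool
  (h , a) ≟G (k , b) = does (h ≟ k) ∧ does (a B≟ b)

  -- subsets of G are Bool-valued predicates; underline Z is ind Z
  SubsetG : Set
  SubsetG = G → Bool

  invSetG : SubsetG → SubsetG
  invSetG Z x = Z (invG x)

  singletonE : SubsetG
  singletonE x = x ≟G eG

  oneG : ZG
  oneG = ind singletonE

  mulZG : ZG → ZG → ZG
  mulZG a b x = sumG (λ y → a y * b (invG y ·G x))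

  IsPartitionG : List SubsetG → Set
  IsPartitionG S =
    ∀ x → Σ (Fin (length S)) λ i →
      (lookup S i x ≡ true) × (∀ j → lookup S j x ≡ true → j ≡ i)

  _∈S_ : SubsetG → List SubsetG → Set
  Z ∈S S = Σ (Fin (length S)) λ i → ∀ x → lookup S i x ≡ Z x

  InSpan : List SubsetG → ZG → Set
  InSpan S f = Σ (Fin (length S) → ℤ) λ c →
    ∀ x → f x ≡ sumFin (length S) (λ i → c i * ind (lookup S i) x)

  IsSubringZG : (ZG → Set) → Set
  IsSubringZG P =
    P zeroG × P oneG
    × (∀ a b → P a → P b → P (a +G b))
    × (∀ a → P a → P (negG a))
    × (∀ a b → P a → P b → P (mulZG a b))

  IsSRing : List SubsetG → Set
  IsSRing S =
    IsPartitionG S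
    × (singletonE ∈S S)
    × (∀ i → invSetG (lookup S i) ∈S S)
    × IsSubringZG (InSpan S)

  Agen : SubsetG
  Agen (h , false) = Aset h
  Agen (h , true)  = false

  Xset : (Fin n → Bool) → SubsetG
  Xset D (h , false) = false
  Xset D (h , true)  = D h

  Yset : (Fin n → Bool) → SubsetG
  Yset D (h , false) = false
  Yset D (h , true)  = not (D h)

  partitionS : (Fin n → Bool) → List SubsetG
  partitionS D = singletonE ∷ Agen ∷ Xset D ∷ Yset D ∷ []

-- On H an element of the span of {e}, A, X, Y has the form p + q δₑ, and on the coset Hg
-- (the pairs (h , true)) the form r + s 𝟙_D; call (p, q, r, s) its coordinates.  Zero, one,
-- sums and negatives visibly have coordinates.  The value of a product at k or at kg splits
-- into four sums over H of products of two such affine expressions; after the substitutions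
-- h ↦ h⁻¹k and h ↦ hk⁻¹ each sum that occurs is 1, |D|, δₑ(k) or 𝟙_D(k), except
-- Σₕ 𝟙_D(h) 𝟙_D(hk⁻¹), the number of ways of writing k as a quotient of two elements of D,
-- which the difference set property makes λ + (|D| − λ) δₑ(k).
module Submission where

open import Defs
open import Level using (0ℓ)
open import Algebra.Bundles using (Group)
import Algebra.Properties.Group as GroupProperties
import Algebra.Properties.Loop as LoopProperties
import Algebra.Properties.CommutativeMonoid.Sum as CommutativeMonoidSum
import Algebra.Properties.Semiring.Sum as SemiringSum
open import Data.Nat using (ℕ; zero; suc)
open import Data.Fin using (Fin; zero; suc)
open import Data.Fin.Patterns using (0F; 1F; 2F; 3F)
open import Data.Fin.Properties using (_≟_)
open import Data.Fin.Permutation using (Permutation; permutation; _⟨$⟩ʳ_)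
open import Data.Bool using (Bool; true; false; not; _∧_; if_then_else_)
open import Data.Bool.Properties using (∧-identityʳ; ∧-zeroʳ)
open import Data.Integer using (ℤ; 0ℤ; 1ℤ; _+_; _*_; -_; _-_; _<_)
import Data.Integer.Properties as ℤ
open import Data.Integer.Tactic.RingSolver using (solve-∀)
open import Data.Product using (_,_)
open import Data.List using (List; lookup)
open import Function using (_∘_)
open import Function.Bundles using (mk⇔)
open import Relation.Nullary using (does; yes; no; ¬_; contradiction)
open import Relation.Nullary.Decidable using (does-⇔; dec-false)
open import Relation.Binary.PropositionalEquality

χ : Bool → ℤ
χ b = if b then 1ℤ else 0ℤ

χ-not : ∀ b → χ (not b) ≡ 1ℤ - χ b
χ-not true  = refl
χ-not false = refl

χ-idem : ∀ b → χ b * χ b ≡ χ b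
χ-idem true  = refl
χ-idem false = refl

δ : ∀ {m} → Fin m → Fin m → ℤ
δ k i = χ (does (i ≟ k))

δ-comm : ∀ {m} (k i : Fin m) → δ k i ≡ δ i k
δ-comm k i = cong χ (does-⇔ (mk⇔ sym sym) (i ≟ k) (k ≟ i))

module Σ = CommutativeMonoidSum ℤ.+-0-commutativeMonoid
open SemiringSum ℤ.+-*-semiring using (*-distribˡ-sum)

sumFin≡sum : ∀ {m} (f : Fin m → ℤ) → sumFin m f ≡ Σ.sum f
sumFin≡sum {zero}  f = refl
sumFin≡sum {suc m} f = cong (f zero +_) (sumFin≡sum (f ∘ suc))

sumFin-cong : ∀ m {f g : Fin m → ℤ} → (∀ i → f i ≡ g i) → sumFin m f ≡ sumFin m g
sumFin-cong zero    f≗g = refl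
sumFin-cong (suc m) f≗g = cong₂ _+_ (f≗g zero) (sumFin-cong m (f≗g ∘ suc))

sumFin-zero : ∀ m → sumFin m (λ _ → 0ℤ) ≡ 0ℤ
sumFin-zero m rewrite sumFin≡sum {m} (λ _ → 0ℤ) = Σ.sum-replicate-zero m

sumFin-distrib-+ : ∀ m (f g : Fin m → ℤ) →
  sumFin m (λ i → f i + g i) ≡ sumFin m f + sumFin m g
sumFin-distrib-+ m f g
  rewrite sumFin≡sum (λ i → f i + g i) | sumFin≡sum f | sumFin≡sum g = Σ.∑-distrib-+ f g

*-distribˡ-sumFin : ∀ m x (f : Fin m → ℤ) → x * sumFin m f ≡ sumFin m (λ i → x * f i)
*-distribˡ-sumFin m x f
  rewrite sumFin≡sum f | sumFin≡sum (λ i → x * f i) = *-distribˡ-sum x f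

sumFin-permute : ∀ m (f : Fin m → ℤ) (π : Permutation m m) →
  sumFin m f ≡ sumFin m (f ∘ (π ⟨$⟩ʳ_))
sumFin-permute m f π
  rewrite sumFin≡sum f | sumFin≡sum (f ∘ (π ⟨$⟩ʳ_)) = Σ.sum-permute f π

sumFin-δ* : ∀ m (k : Fin m) (f : Fin m → ℤ) → sumFin m (λ i → δ k i * f i) ≡ f k
sumFin-δ* (suc m) zero f =
  trans (cong₂ _+_ (ℤ.*-identityˡ (f zero)) (sumFin-zero m)) (ℤ.+-identityʳ (f zero))
sumFin-δ* (suc m) (suc k) f =
  trans (ℤ.+-identityˡ _) (sumFin-δ* m k (f ∘ suc))

sumFin-δ : ∀ m (k : Fin m) → sumFin m (δ k) ≡ 1ℤ
sumFin-δ m k = trans (sumFin-cong m (λ i → sym (ℤ.*-identityʳ (δ k i)))) (sumFin-δ* m k (λ _ → 1ℤ))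

expand-affine-* : ∀ p q p′ q′ x y →
  (p + q * x) * (p′ + q′ * y) ≡ p * p′ + p * q′ * y + q * p′ * x + q * q′ * (x * y)
expand-affine-* = solve-∀

sumFin-affine-* : ∀ m (X Y : Fin m → ℤ) p q p′ q′ {x y z} →
  sumFin m X ≡ x → sumFin m Y ≡ y → sumFin m (λ i → X i * Y i) ≡ z →
  sumFin m (λ i → (p + q * X i) * (p′ + q′ * Y i)) ≡
  sumFin m (λ _ → p * p′) + p * q′ * y + q * p′ * x + q * q′ * z
sumFin-affine-* m X Y p q p′ q′ {x} {y} {z} ΣX ΣY ΣXY = begin
  sumFin m (λ i → (p + q * X i) * (p′ + q′ * Y i))
    ≡⟨ sumFin-cong m (λ i → expand-affine-* p q p′ q′ (X i) (Y i)) ⟩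
  sumFin m (λ i → p * p′ + p * q′ * Y i + q * p′ * X i + q * q′ * (X i * Y i))
    ≡⟨ trans (sumFin-distrib-+ m _ _) (cong (_+ _)
         (trans (sumFin-distrib-+ m _ _) (cong (_+ _) (sumFin-distrib-+ m _ _)))) ⟩
  sumFin m (λ _ → p * p′) + sumFin m (λ i → p * q′ * Y i)
    + sumFin m (λ i → q * p′ * X i) + sumFin m (λ i → q * q′ * (X i * Y i))
    ≡⟨ cong₂ _+_ (cong₂ _+_ (cong (sumFin m (λ _ → p * p′) +_) (scale (p * q′) ΣY)) (scale (q * p′) ΣX))
                 (scale (q * q′) ΣXY) ⟩
  sumFin m (λ _ → p * p′) + p * q′ * y + q * p′ * x + q * q′ * z ∎
  where
  open ≡-Reasoning
  scale : ∀ c {f : Fin m → ℤ} {v} → sumFin m f ≡ v → sumFin m (λ i → c * f i) ≡ c * v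
  scale c {f} Σf = trans (sym (*-distribˡ-sumFin m c f)) (cong (c *_) Σf)

module FinAbGroupProperties {n : ℕ} (H : FinAbGroup n) where
  open FinAbGroup H

  group : Group 0ℓ 0ℓ
  group = record
    { Carrier = Fin n ; _≈_ = _≡_ ; _∙_ = _·_ ; ε = e ; _⁻¹ = inv
    ; isGroup = record
      { isMonoid = record
        { isSemigroup = record
          { isMagma = record { isEquivalence = isEquivalence ; ∙-cong = cong₂ _·_ }
          ; assoc = assoc }
        ; identity = identityˡ , identityʳ }
      ; inverse = inverseˡ , inverseʳ
      ; ⁻¹-cong = cong inv } }

  open Group group public using (_\\_; _//_)
  open GroupProperties group public
    using (loop; ε⁻¹≈ε; ⁻¹-injective; x∙y⁻¹≈ε⇒x≈y; x≈y⇒x∙y⁻¹≈ε; ⁻¹-anti-homo-\\;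
           //-rightDividesˡ; //-rightDividesʳ; \\-leftDividesˡ)
  open LoopProperties loop public using (ε\\x≈x; x//ε≈x)

  \\-involutiveˡ : ∀ k h → (h \\ k) \\ k ≡ h
  \\-involutiveˡ k h = begin
    inv (h \\ k) · k ≡⟨ cong (_· k) (⁻¹-anti-homo-\\ h k) ⟩
    (k \\ h) · k     ≡⟨ comm (k \\ h) k ⟩
    k · (k \\ h)     ≡⟨ \\-leftDividesˡ k h ⟩
    h                ∎
    where open ≡-Reasoning

  x⁻¹∙y≡e⇒x≡y : ∀ h k → inv h · k ≡ e → h ≡ k
  x⁻¹∙y≡e⇒x≡y h k h⁻¹k≡e = sym (x∙y⁻¹≈ε⇒x≈y k h (trans (comm k (inv h)) h⁻¹k≡e))

  δe-\\ : ∀ h k → δ e (h \\ k) ≡ δ k h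
  δe-\\ h k = cong χ (does-⇔ (mk⇔ (x⁻¹∙y≡e⇒x≡y h k) λ { refl → inverseˡ h }) (h \\ k ≟ e) (h ≟ k))

  δe-// : ∀ h k → δ e (h // k) ≡ δ k h
  δe-// h k = cong χ (does-⇔ (mk⇔ (x∙y⁻¹≈ε⇒x≈y h k) x≈y⇒x∙y⁻¹≈ε) (h // k ≟ e) (h ≟ k))

  does-inv≟e : ∀ h → does (inv h ≟ e) ≡ does (h ≟ e)
  does-inv≟e h = does-⇔ (mk⇔ (λ h⁻¹≡e → ⁻¹-injective (trans h⁻¹≡e (sym ε⁻¹≈ε)))
                             λ { refl → ε⁻¹≈ε }) (inv h ≟ e) (h ≟ e)

  sumH-// : ∀ k (f : Fin n → ℤ) → sumFin n (λ h → f (h // k)) ≡ sumFin n f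
  sumH-// k f = sym (sumFin-permute n f
    (permutation (_// k) (_· k) (//-rightDividesʳ k) (//-rightDividesˡ k)))

  sumH-\\ : ∀ k (f : Fin n → ℤ) → sumFin n (λ h → f (h \\ k)) ≡ sumFin n f
  sumH-\\ k f = sym (sumFin-permute n f
    (permutation (_\\ k) (_\\ k) (\\-involutiveˡ k) (\\-involutiveˡ k)))

module SRing {n : ℕ} (H : FinAbGroup n) (D : Fin n → Bool) (λ' : ℤ)
             (isDifferenceSet : Dihedral.IsDifferenceSet H D λ') where
  open FinAbGroup H
  open Dihedral H
  open FinAbGroupProperties H

  S : List SubsetG
  S = partitionS D

  𝟙D : Fin n → ℤ
  𝟙D h = χ (D h)

  ∣D∣ : ℤ
  ∣D∣ = sumH 𝟙D

  difference-count-e : sumH (λ h → 𝟙D h * 𝟙D (h // e)) ≡ ∣D∣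
  difference-count-e =
    sumFin-cong n (λ h → trans (cong (λ x → 𝟙D h * 𝟙D x) (x//ε≈x h)) (χ-idem (D h)))

  difference-count-≢e : ∀ k → ¬ k ≡ e → sumH (λ h → 𝟙D h * 𝟙D (h // k)) ≡ λ'
  difference-count-≢e k k≢e = begin
    sumH (λ h → 𝟙D h * 𝟙D (h // k))
      ≡⟨ sumFin-cong n (λ h → cong (λ x → 𝟙D h * 𝟙D x) (inv-\\ h k)) ⟨
    mulZH (ind D) (ind (invSetH D)) k                  ≡⟨ ℤ.*-identityʳ _ ⟨
    mulZH (ind D) (ind (invSetH D)) k * 1ℤ             ≡⟨ cong (mulZH (ind D) (ind (invSetH D)) k *_) k∈A ⟨
    (mulZH (ind D) (ind (invSetH D)) ∘H ind Aset) k    ≡⟨ isDifferenceSet k ⟩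
    λ' * ind Aset k                                    ≡⟨ trans (cong (λ' *_) k∈A) (ℤ.*-identityʳ λ') ⟩
    λ'                                                 ∎
    where
    open ≡-Reasoning
    k∈A : ind Aset k ≡ 1ℤ
    k∈A = cong (χ ∘ not) (dec-false (k ≟ e) k≢e)
    inv-\\ : ∀ h k → inv (h \\ k) ≡ h // k
    inv-\\ h k = trans (⁻¹-anti-homo-\\ h k) (comm (inv k) h)

  difference-count : ∀ k → sumH (λ h → 𝟙D h * 𝟙D (h // k)) ≡ λ' + (∣D∣ - λ') * δ e k
  difference-count k with k ≟ e
  ... | yes refl = trans difference-count-e (at-1 ∣D∣ λ')
    where
    at-1 : ∀ a b → a ≡ b + (a - b) * 1ℤ
    at-1 = solve-∀
  ... | no k≢e   = trans (difference-count-≢e k k≢e) (at-0 ∣D∣ λ')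
    where
    at-0 : ∀ a b → b ≡ b + (a - b) * 0ℤ
    at-0 = solve-∀

  record Coordinates (f : ZG) : Set where
    field
      p q r s : ℤ
      onH  : ∀ h → f (h , false) ≡ p + q * δ e h
      onHg : ∀ h → f (h , true)  ≡ r + s * 𝟙D h

  span-onH : ∀ (c : Fin 4 → ℤ) h →
    sumFin 4 (λ i → c i * ind (lookup S i) (h , false)) ≡ c 1F + (c 0F - c 1F) * δ e h
  span-onH c h rewrite ∧-identityʳ (does (h ≟ e)) | χ-not (does (h ≟ e)) =
    collect (c 0F) (c 1F) (c 2F) (c 3F) (δ e h)
    where
    collect : ∀ c₀ c₁ c₂ c₃ t →
      c₀ * t + (c₁ * (1ℤ - t) + (c₂ * 0ℤ + (c₃ * 0ℤ + 0ℤ))) ≡ c₁ + (c₀ - c₁) * t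
    collect = solve-∀

  span-onHg : ∀ (c : Fin 4 → ℤ) h →
    sumFin 4 (λ i → c i * ind (lookup S i) (h , true))
      ≡ c 3F + (c 2F - c 3F) * 𝟙D h
  span-onHg c h rewrite ∧-zeroʳ (does (h ≟ e)) | χ-not (D h) =
    collect (c 0F) (c 1F) (c 2F) (c 3F) (𝟙D h)
    where
    collect : ∀ c₀ c₁ c₂ c₃ t →
      c₀ * 0ℤ + (c₁ * 0ℤ + (c₂ * t + (c₃ * (1ℤ - t) + 0ℤ))) ≡ c₃ + (c₂ - c₃) * t
    collect = solve-∀

  InSpan⇒Coordinates : ∀ {f} → InSpan S f → Coordinates f
  InSpan⇒Coordinates (c , f≡) = record
    { p = c 1F ; q = c 0F - c 1F ; r = c 3F ; s = c 2F - c 3F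
    ; onH  = λ h → trans (f≡ (h , false)) (span-onH c h)
    ; onHg = λ h → trans (f≡ (h , true)) (span-onHg c h) }

  Coordinates⇒InSpan : ∀ {f} → Coordinates f → InSpan S f
  Coordinates⇒InSpan {f} F = c , f≡
    where
    open Coordinates F
    c : Fin 4 → ℤ
    c 0F = p + q
    c 1F = p
    c 2F = r + s
    c 3F = r
    [a+b]-a≡b : ∀ a b → a + b - a ≡ b
    [a+b]-a≡b = solve-∀
    f≡ : ∀ x → f x ≡ sumFin 4 (λ i → c i * ind (lookup S i) x)
    f≡ (h , false) = trans (onH h)  (sym (trans (span-onH c h)  (cong (λ t → p + t * δ e h) ([a+b]-a≡b p q))))
    f≡ (h , true)  = trans (onHg h) (sym (trans (span-onHg c h) (cong (λ t → r + t * 𝟙D h) ([a+b]-a≡b r s))))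

  zero-coordinates : Coordinates zeroG
  zero-coordinates = record { p = 0ℤ ; q = 0ℤ ; r = 0ℤ ; s = 0ℤ ; onH = λ _ → refl ; onHg = λ _ → refl }

  one-coordinates : Coordinates oneG
  one-coordinates = record
    { p = 0ℤ ; q = 1ℤ ; r = 0ℤ ; s = 0ℤ
    ; onH  = λ h → trans (cong χ (∧-identityʳ (does (h ≟ e))))
                         (sym (trans (ℤ.+-identityˡ _) (ℤ.*-identityˡ (δ e h))))
    ; onHg = λ h → cong χ (∧-zeroʳ (does (h ≟ e))) }

  +-coordinates : ∀ {a b} → Coordinates a → Coordinates b → Coordinates (a +G b)
  +-coordinates A B = record
    { p = A.p + B.p ; q = A.q + B.q ; r = A.r + B.r ; s = A.s + B.s
    ; onH  = λ h → trans (cong₂ _+_ (A.onH h) (B.onH h)) (affine-+ A.p A.q B.p B.q (δ e h))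
    ; onHg = λ h → trans (cong₂ _+_ (A.onHg h) (B.onHg h)) (affine-+ A.r A.s B.r B.s (𝟙D h)) }
    where
    module A = Coordinates A
    module B = Coordinates B
    affine-+ : ∀ p q p′ q′ t → (p + q * t) + (p′ + q′ * t) ≡ (p + p′) + (q + q′) * t
    affine-+ = solve-∀

  neg-coordinates : ∀ {a} → Coordinates a → Coordinates (negG a)
  neg-coordinates A = record
    { p = - A.p ; q = - A.q ; r = - A.r ; s = - A.s
    ; onH  = λ h → trans (cong -_ (A.onH h)) (affine-neg A.p A.q (δ e h))
    ; onHg = λ h → trans (cong -_ (A.onHg h)) (affine-neg A.r A.s (𝟙D h)) }
    where
    module A = Coordinates A
    affine-neg : ∀ p q t → - (p + q * t) ≡ - p + - q * t
    affine-neg = solve-∀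

  module _ {a b : ZG} (A : Coordinates a) (B : Coordinates b) where
    open Coordinates A
    open Coordinates B renaming (p to p′; q to q′; r to r′; s to s′; onH to onH′; onHg to onHg′)

    -- The XY-part is the contribution of a on the coset X and b on the coset Y to the
    -- product; the value of mulZG a b at (k , false) is HH + HgHg, at (k , true) HHg + HgH.
    HH₀ HgHg₀ HHg₀ HgH₀ : ℤ
    HH₀   = sumH (λ _ → p * p′) + p * q′ * 1ℤ + q * p′ * 1ℤ
    HgHg₀ = sumH (λ _ → r * r′) + r * s′ * ∣D∣ + s * r′ * ∣D∣
    HHg₀  = sumH (λ _ → p * r′) + p * s′ * ∣D∣ + q * r′ * 1ℤ
    HgH₀  = sumH (λ _ → r * p′) + r * q′ * 1ℤ + s * p′ * ∣D∣

    b-on-H\\ : ∀ h k → b (h \\ k , false) ≡ p′ + q′ * δ k h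
    b-on-H\\ h k = trans (onH′ (h \\ k)) (cong (λ t → p′ + q′ * t) (δe-\\ h k))

    b-on-H// : ∀ h k → b (h // k , false) ≡ p′ + q′ * δ k h
    b-on-H// h k = trans (onH′ (h // k)) (cong (λ t → p′ + q′ * t) (δe-// h k))

    HH-part : ∀ k → sumH (λ h → a (h , false) * b (h \\ k , false)) ≡ HH₀ + q * q′ * δ e k
    HH-part k =
      trans (sumFin-cong n (λ h → cong₂ _*_ (onH h) (b-on-H\\ h k)))
            (sumFin-affine-* n (δ e) (δ k) p q p′ q′ (sumFin-δ n e) (sumFin-δ n k)
               (trans (sumFin-δ* n e (δ k)) (δ-comm k e)))

    HgHg-part : ∀ k → sumH (λ h → a (h , true) * b (h // k , true))
      ≡ HgHg₀ + s * s′ * (λ' + (∣D∣ - λ') * δ e k)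
    HgHg-part k =
      trans (sumFin-cong n (λ h → cong₂ _*_ (onHg h) (onHg′ (h // k))))
            (sumFin-affine-* n 𝟙D (λ h → 𝟙D (h // k)) r s r′ s′
               refl (sumH-// k 𝟙D) (difference-count k))

    HHg-part : ∀ k → sumH (λ h → a (h , false) * b (h \\ k , true)) ≡ HHg₀ + q * s′ * 𝟙D k
    HHg-part k =
      trans (sumFin-cong n (λ h → cong₂ _*_ (onH h) (onHg′ (h \\ k))))
            (sumFin-affine-* n (δ e) (λ h → 𝟙D (h \\ k)) p q r′ s′
               (sumFin-δ n e) (sumH-\\ k 𝟙D)
               (trans (sumFin-δ* n e (λ h → 𝟙D (h \\ k))) (cong 𝟙D (ε\\x≈x k))))

    HgH-part : ∀ k → sumH (λ h → a (h , true) * b (h // k , false)) ≡ HgH₀ + s * q′ * 𝟙D k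
    HgH-part k =
      trans (sumFin-cong n (λ h → cong₂ _*_ (onHg h) (b-on-H// h k)))
            (sumFin-affine-* n 𝟙D (δ k) r s p′ q′ refl (sumFin-δ n k)
               (trans (sumFin-cong n (λ h → ℤ.*-comm (𝟙D h) (δ k h))) (sumFin-δ* n k 𝟙D)))

    *-coordinates : Coordinates (mulZG a b)
    *-coordinates = record
      { p = HH₀ + HgHg₀ + s * s′ * λ' ; q = q * q′ + s * s′ * (∣D∣ - λ')
      ; r = HHg₀ + HgH₀               ; s = q * s′ + s * q′
      ; onH  = λ k → trans (cong₂ _+_ (HH-part k) (HgHg-part k))
                           (collect-onH HH₀ (q * q′) HgHg₀ (s * s′) λ' (∣D∣ - λ') (δ e k))
      ; onHg = λ k → trans (cong₂ _+_ (HHg-part k) (HgH-part k))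
                           (collect-onHg HHg₀ (q * s′) HgH₀ (s * q′) (𝟙D k)) }
      where
      collect-onH : ∀ c u c′ v l m t →
        (c + u * t) + (c′ + v * (l + m * t)) ≡ (c + c′ + v * l) + (u + v * m) * t
      collect-onH = solve-∀
      collect-onHg : ∀ c u c′ v t → (c + u * t) + (c′ + v * t) ≡ (c + c′) + (u + v) * t
      collect-onHg = solve-∀

  isPartition : IsPartitionG S
  isPartition (h , false) with does (h ≟ e) in h≟e
  ... | true  = 0F , trans (∧-identityʳ _) h≟e , λ
    { 0F _ → refl ; 1F h∈A → contradiction (trans (cong not (sym h≟e)) h∈A) λ () ; 2F () ; 3F () }
  ... | false = 1F , cong not h≟e , λ
    { 0F h∈e → contradiction (trans (cong (_∧ true) (sym h≟e)) h∈e) λ ()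
    ; 1F _ → refl ; 2F () ; 3F () }
  isPartition (h , true) with D h in h∈D
  ... | true  = 2F , h∈D , λ
    { 0F h∈e → contradiction (trans (sym (∧-zeroʳ _)) h∈e) λ () ; 1F () ; 2F _ → refl
    ; 3F h∉D → contradiction (trans (cong not (sym h∈D)) h∉D) λ () }
  ... | false = 3F , cong not h∈D , λ
    { 0F h∈e → contradiction (trans (sym (∧-zeroʳ _)) h∈e) λ () ; 1F ()
    ; 2F h∈D′ → contradiction (trans (sym h∈D) h∈D′) λ () ; 3F _ → refl }

  inverse-closed : ∀ i → invSetG (lookup S i) ∈S S
  inverse-closed 0F = 0F , λ { (h , false) → cong (_∧ true) (sym (does-inv≟e h)) ; (h , true) → refl }
  inverse-closed 1F = 1F , λ { (h , false) → cong not (sym (does-inv≟e h)) ; (h , true) → refl }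
  inverse-closed 2F = 2F , λ { (h , false) → refl ; (h , true) → refl }
  inverse-closed 3F = 3F , λ { (h , false) → refl ; (h , true) → refl }

  isSubring : IsSubringZG (InSpan S)
  isSubring =
      Coordinates⇒InSpan zero-coordinates
    , Coordinates⇒InSpan one-coordinates
    , (λ _ _ a∈ b∈ → Coordinates⇒InSpan
                       (+-coordinates (InSpan⇒Coordinates a∈) (InSpan⇒Coordinates b∈)))
    , (λ _ a∈ → Coordinates⇒InSpan (neg-coordinates (InSpan⇒Coordinates a∈)))
    , (λ _ _ a∈ b∈ → Coordinates⇒InSpan
                       (*-coordinates (InSpan⇒Coordinates a∈) (InSpan⇒Coordinates b∈)))

lemma5p1 : {n : ℕ} (H : FinAbGroup n) (D : Fin n → Bool) (λ' : ℤ) →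
    0ℤ < λ' → Dihedral.IsDifferenceSet H D λ' →
    Dihedral.IsSRing H (Dihedral.partitionS H D)
lemma5p1 H D λ' _ isDifferenceSet = isPartition , (0F , λ _ → refl) , inverse-closed , isSubring
  where open SRing H D λ' isDifferenceSet
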